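{- Let $\tau$ be a weakly generic tame type as below, with $r\in\{2,3\}$, and let $(s_j)_{j\in\mathbb Z/f}\in S_3^f$ be the orientation of $(\mathbf a_1,\mathbf a_2,\mathbf a_3)$. For $0\le j\le f-1$ and $0\le i\le r-1$ define $s'_{j+if}=s_\tau^{i+1}\circ s_j\in S_3$, where $s_\tau=(23)$ if $r=2$ and $s_\tau=(123)$ if $r=3$. Then $(s'_{j'})_{j'\in\mathbb Z/f'}\in S_3^{f'}$ is an orientation of $\tau'$.
   Context: $p>3$, $f\ge1$, $r\in\{2,3\}$, $f'=fr$. For $\mathbf a_k=(a_{k,j})_{j\in\mathbb Z/f}\in\{0,\dots,p-1\}^f$ put $\mathbf a_k^{(j)}=\sum_{i=0}^{f-1}a_{k,-j+i}p^i$. Let $\omega_{f'}$ be a fundamental character of niveau $f'$ of $I_{\mathbb Q_{p^{f'}}}$ with $\omega_{f'}^{(p^{f'}-1)/(p^f-1)}=\omega_f$. The tame type $\tau$ of $I_{\mathbb Q_{p^f}}$ is: for $r=2$, $\omega_{f'}^{ -\mathbf a_1^{(0)}-p^f\mathbf a_1^{(0)}}\oplus\omega_{f'}^{ -\mathbf a_2^{(0)}-p^f\mathbf a_3^{(0)}}\oplus\omega_{f'}^{ -\mathbf a_3^{(0)}-p^f\mathbf a_2^{(0)}}$; for $r=3$, $\omega_{f'}^{ -\mathbf a_1^{(0)}-p^f\mathbf a_2^{(0)}-p^{2f}\mathbf a_3^{(0)}}\oplus\omega_{f'}^{ -\mathbf a_2^{(0)}-p^f\mathbf a_3^{(0)}-p^{2f}\mathbf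 a_1^{(0)}}\oplus\omega_{f'}^{ -\mathbf a_3^{(0)}-p^f\mathbf a_1^{(0)}-p^{2f}\mathbf a_2^{(0)}}$. $\tau'$ is $\tau$ viewed as a type of $I_{\mathbb Q_{p^{f'}}}$, written $\tau'=\eta_1\oplus\eta_2\oplus\eta_3$ (in the order above) with $\eta_k=\omega_{f'}^{ -\mathbf a_k'^{(0)}}$ for unique $\mathbf a'_k\in\{0,\dots,p-1\}^{f'}$, $\mathbf a_k'^{(j')}=\sum_{i=0}^{f'-1}a'_{k,-j'+i}p^i$. An orientation of a triple $(\mathbf b_1,\mathbf b_2,\mathbf b_3)$ of $g$-tuples is $(t_j)\in S_3^g$ with $\mathbf b^{(j)}_{t_j(1)}\ge\mathbf b^{(j)}_{t_j(2)}\ge\mathbf b^{(j)}_{t_j(3)}$ for all $j$; an orientation of $\tau'$ is one of $(\mathbf a'_1,\mathbf a'_2,\mathbf a'_3)$. $\tau$ is weakly generic if $3\le|a_{1,j}-a_{2,j}|,|a_{2,j}-a_{3,j}|,|a_{1,j}-a_{3,j}|\le p-4$ for all $j$. -}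

module Defs where

open import Data.Nat using (ℕ; zero; suc; _+_; _*_; _∸_; _^_; _≤_; _<_; _≥_; NonZero; ∣_-_∣)
open import Data.Nat.Properties using (m^n≢0)
open import Data.Nat.DivMod using (_/_; _%_; m%n<n)
open import Data.Nat.Primality using (Prime)
open import Data.Fin using (Fin; zero; suc; toℕ; fromℕ<)
open import Data.Fin.Permutation using (Permutation′; permutation; transpose; id; _∘ₚ_; _⟨$⟩ʳ_)
open import Data.Product using (_×_)
open import Data.Sum using (_⊎_)
open import Relation.Binary.PropositionalEquality using (_≡_; refl)

-- The symmetric group S₃, acting on Fin 3 = {0,1,2} (paper's {1,2,3}).
S₃ : Set
S₃ = Permutation′ 3

Σ< : ℕ → (ℕ → ℕ) → ℕ
Σ< zero    g = 0
Σ< (suc n) g = Σ< n g + g n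

negPlus : (g : ℕ) → Fin g → ℕ → Fin g
negPlus zero    ()
negPlus (suc h) j i = fromℕ< (m%n<n (i + (suc h ∸ toℕ j)) (suc h))

sh : (g p : ℕ) → (Fin g → ℕ) → Fin g → ℕ
sh g p b j = Σ< g (λ i → b (negPlus g j i) * p ^ i)

IsOrientation : (g p : ℕ) → (Fin 3 → Fin g → ℕ) → (Fin g → S₃) → Set
IsOrientation g p b t = (j : Fin g) →
  (sh g p (b (t j ⟨$⟩ʳ zero)) j ≥ sh g p (b (t j ⟨$⟩ʳ suc zero)) j)
  × (sh g p (b (t j ⟨$⟩ʳ suc zero)) j ≥ sh g p (b (t j ⟨$⟩ʳ suc (suc zero))) j)

WeaklyGeneric : (p f : ℕ) → (Fin 3 → Fin f → ℕ) → Set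
WeaklyGeneric p f a = (j : Fin f) →
  Bnd (a zero j) (a (suc zero) j) × Bnd (a (suc zero) j) (a (suc (suc zero)) j)
  × Bnd (a zero j) (a (suc (suc zero)) j)
  where
  Bnd : ℕ → ℕ → Set
  Bnd x y = (3 ≤ ∣ x - y ∣) × (∣ x - y ∣ ≤ p ∸ 4)

cyc : Fin 3 → Fin 3
cyc zero = suc zero
cyc (suc zero) = suc (suc zero)
cyc (suc (suc zero)) = zero

cyc⁻¹ : Fin 3 → Fin 3
cyc⁻¹ zero = suc (suc zero)
cyc⁻¹ (suc zero) = zero
cyc⁻¹ (suc (suc zero)) = suc zero

c123 : S₃
c123 = permutation cyc cyc⁻¹ inv₁ inv₂
  where
  inv₁ : ∀ x → cyc (cyc⁻¹ x) ≡ x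
  inv₁ zero = refl
  inv₁ (suc zero) = refl
  inv₁ (suc (suc zero)) = refl
  inv₂ : ∀ x → cyc⁻¹ (cyc x) ≡ x
  inv₂ zero = refl
  inv₂ (suc zero) = refl
  inv₂ (suc (suc zero)) = refl

-- s_τ = (23) if r = 2, (123) if r = 3 (arbitrary, irrelevant otherwise)
sτ : ℕ → S₃
sτ 2 = transpose (suc zero) (suc (suc zero))
sτ 3 = c123
sτ _ = id

pow : S₃ → ℕ → S₃
pow s zero    = id
pow s (suc n) = pow s n ∘ₚ s

-- s'_{j+if} = s_τ^{i+1} ∘ s_j   (j' = j + i f, j = j' mod f, i = j' div f);
-- note π ∘ₚ ρ applies π first, so s_τ^{i+1} ∘ s_j = s_j ∘ₚ s_τ^{i+1}
s′ : (f r : ℕ) .{{_ : NonZero f}} → (Fin f → S₃) → Fin (f * r) → S₃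
s′ f r s j′ =
  s (fromℕ< (m%n<n (toℕ j′) f)) ∘ₚ pow (sτ r) (suc (toℕ j′ / f))

A0 : (p f : ℕ) .{{_ : NonZero f}} → (Fin 3 → Fin f → ℕ) → Fin 3 → ℕ
A0 p f a k = Σ< f (λ i → a k (fromℕ< (m%n<n i f)) * p ^ i)

-- exponent N_k with τ = ⊕_k ω_{f'}^{-N_k}, in the order of the paper
τexp : (p f r : ℕ) .{{_ : NonZero f}} → (Fin 3 → Fin f → ℕ) → Fin 3 → ℕ
τexp p f 2 a zero             = A0 p f a zero + p ^ f * A0 p f a zero
τexp p f 2 a (suc zero)       = A0 p f a (suc zero) + p ^ f * A0 p f a (suc (suc zero))
τexp p f 2 a (suc (suc zero)) = A0 p f a (suc (suc zero)) + p ^ f * A0 p f a (suc zero)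
τexp p f 3 a zero             =
  A0 p f a zero + p ^ f * A0 p f a (suc zero) + p ^ (2 * f) * A0 p f a (suc (suc zero))
τexp p f 3 a (suc zero)       =
  A0 p f a (suc zero) + p ^ f * A0 p f a (suc (suc zero)) + p ^ (2 * f) * A0 p f a zero
τexp p f 3 a (suc (suc zero)) =
  A0 p f a (suc (suc zero)) + p ^ f * A0 p f a zero + p ^ (2 * f) * A0 p f a (suc zero)
τexp p f _ a k = 0

digit : (p n i : ℕ) → ℕ
digit zero    n i = 0
digit (suc q) n i = (_/_ n (suc q ^ i) ⦃ m^n≢0 (suc q) i ⦄) % suc q

-- a'_k ∈ {0..p-1}^{f'}: the base-p digits of N_k (N_k < p^{f'}), so that
-- η_k = ω_{f'}^{-N_k} = ω_{f'}^{-a'_k^{(0)}}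
a′ : (p f r : ℕ) .{{_ : NonZero f}} → (Fin 3 → Fin f → ℕ) → Fin 3 → Fin (f * r) → ℕ
a′ p f r a k i = digit p (τexp p f r a k) (toℕ i)

{-# OPTIONS --safe #-}
-- Weak genericity makes the digits a₁,ⱼ, a₂,ⱼ, a₃,ⱼ pairwise distinct, so the order of the
-- numbers a_k^{(j)} is already decided by their leading base-p digits a_{k,−j−1}.  The base-p
-- digits of the exponent of η_k consist of r blocks of f digits, block c being those of
-- a_{s_τ^c(k)}; hence the leading digit of a′^{(j+if)}_{s′_{j+if}(x)} sits in block r − 1 − i and
-- equals the leading digit of a^{(j)}_{s_j(x)}, because s_τ^{r−1−i} s_τ^{i+1} = s_τ^r = 1.
-- So s′ orders the a′_k exactly as s orders the a_k.
module Submission where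

open import Defs
open import Data.Fin using (Fin; toℕ; fromℕ<)
open import Data.Fin.Patterns using (0F; 1F; 2F)
open import Data.Fin.Permutation using (_⟨$⟩ʳ_)
open import Data.Fin.Properties using (toℕ-fromℕ<; toℕ-injective; toℕ<n)
open import Data.Nat
open import Data.Nat.DivMod
open import Data.Nat.Divisibility using (divides)
open import Data.Nat.Primality using (Prime)
open import Data.Nat.Properties
open import Data.Nat.Tactic.RingSolver using (solve-∀)
open import Data.Product using (_,_; proj₁; proj₂)
open import Data.Sum using (_⊎_; inj₁; inj₂)
open import Function.Base using (_∘_)
open import Function.Bundles using (Injection)
open import Function.Properties.Inverse using (↔⇒↣)
open import Relation.Binary.PropositionalEquality
  using (_≡_; _≢_; refl; sym; trans; cong; cong₂; subst; subst₂; ≢-sym; module ≡-Reasoning)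
open import Relation.Nullary using (contradiction)

-- The coefficient b_{−j−1} of p^{g−1} in b^{(j)}.
leading : (g : ℕ) → (Fin g → ℕ) → Fin g → ℕ
leading g b j = b (negPlus g j (pred g))

module BaseExpansion (q : ℕ) where

  P : ℕ
  P = suc q

  P^-nonZero : ∀ n → NonZero (P ^ n)
  P^-nonZero n = m^n≢0 P n

  infixl 7 _/P^_
  _/P^_ : ℕ → ℕ → ℕ
  x /P^ n = (x / P ^ n) {{P^-nonZero n}}

  expansion : (ℕ → ℕ) → ℕ → ℕ
  expansion d n = Σ< n (λ i → d i * P ^ i)

  digit<P : ∀ x i → digit P x i < P
  digit<P x i = m%n<n (x /P^ i) P

  digit-0-<P : ∀ {x} → x < P → digit P x 0 ≡ x
  digit-0-<P {x} x<P = trans (cong (_% P) (n/1≡n x)) (m<n⇒m%n≡m x<P)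

  [m+kPⁿ]/Pⁿ≡m/Pⁿ+k : ∀ m k n → (m + k * P ^ n) /P^ n ≡ m /P^ n + k
  [m+kPⁿ]/Pⁿ≡m/Pⁿ+k m k n = trans
    (+-distrib-/-∣ʳ m {{P^-nonZero n}} (divides k refl))
    (cong (m /P^ n +_) (m*n/n≡m k (P ^ n) {{P^-nonZero n}}))

  digit-+-*^-low : ∀ X Y {i n} → i < n → digit P (X + P ^ n * Y) i ≡ digit P X i
  digit-+-*^-low X Y {i} i<n with m≤n⇒∃[o]m+o≡n i<n
  ... | k , refl = begin
    (X + P ^ suc (i + k) * Y) /P^ i % P     ≡⟨ cong (λ z → (X + z) /P^ i % P) high-as-multiple ⟩
    (X + P ^ k * Y * P * P ^ i) /P^ i % P   ≡⟨ cong (_% P) ([m+kPⁿ]/Pⁿ≡m/Pⁿ+k X (P ^ k * Y * P) i) ⟩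
    (X /P^ i + P ^ k * Y * P) % P           ≡⟨ [m+kn]%n≡m%n (X /P^ i) (P ^ k * Y) P ⟩
    X /P^ i % P                             ∎
    where
    open ≡-Reasoning
    high-as-multiple : P ^ suc (i + k) * Y ≡ P ^ k * Y * P * P ^ i
    high-as-multiple =
      trans (cong (λ z → P * z * Y) (^-distribˡ-+-* P i k)) (reassociate P (P ^ i) (P ^ k) Y)
      where
      reassociate : ∀ a b c d → a * (b * c) * d ≡ c * d * a * b
      reassociate = solve-∀

  /P^-+ : ∀ x n i → x /P^ (n + i) ≡ x /P^ n /P^ i
  /P^-+ x n i = trans
    (/-congʳ {{P^-nonZero (n + i)}} {{Pⁿ*Pⁱ-nonZero}} (^-distribˡ-+-* P n i))
    (sym (m/n/o≡m/[n*o] x (P ^ n) (P ^ i) {{P^-nonZero n}} {{P^-nonZero i}} {{Pⁿ*Pⁱ-nonZero}}))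
    where
    Pⁿ*Pⁱ-nonZero : NonZero (P ^ n * P ^ i)
    Pⁿ*Pⁱ-nonZero = m*n≢0 (P ^ n) (P ^ i) {{P^-nonZero n}} {{P^-nonZero i}}

  digit-+-*^-high : ∀ {X} Y n i → X < P ^ n → digit P (X + P ^ n * Y) (n + i) ≡ digit P Y i
  digit-+-*^-high {X} Y n i X<Pⁿ = cong (_% P) (begin
    (X + P ^ n * Y) /P^ (n + i)   ≡⟨ /P^-+ (X + P ^ n * Y) n i ⟩
    (X + P ^ n * Y) /P^ n /P^ i   ≡⟨ cong (λ z → (X + z) /P^ n /P^ i) (*-comm (P ^ n) Y) ⟩
    (X + Y * P ^ n) /P^ n /P^ i   ≡⟨ cong (_/P^ i) ([m+kPⁿ]/Pⁿ≡m/Pⁿ+k X Y n) ⟩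
    (X /P^ n + Y) /P^ i           ≡⟨ cong (λ z → (z + Y) /P^ i) (m<n⇒m/n≡0 {{P^-nonZero n}} X<Pⁿ) ⟩
    Y /P^ i                       ∎)
    where open ≡-Reasoning

  +-*^-< : ∀ {X Y n m} → X < P ^ n → Y < P ^ m → X + P ^ n * Y < P ^ (n + m)
  +-*^-< {X} {Y} {n} {m} X<Pⁿ Y<Pᵐ = begin-strict
    X + P ^ n * Y       <⟨ +-monoˡ-< (P ^ n * Y) X<Pⁿ ⟩
    P ^ n + P ^ n * Y   ≡⟨ *-suc (P ^ n) Y ⟨
    P ^ n * suc Y       ≤⟨ *-monoʳ-≤ (P ^ n) Y<Pᵐ ⟩
    P ^ n * P ^ m       ≡⟨ ^-distribˡ-+-* P n m ⟨
    P ^ (n + m)         ∎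
    where open ≤-Reasoning

  expansion-< : ∀ {d} n → (∀ i → d i < P) → expansion d n < P ^ n
  expansion-< zero    d<P = s≤s z≤n
  expansion-< {d} (suc n) d<P = begin-strict
    expansion d n + d n * P ^ n   <⟨ +-monoˡ-< (d n * P ^ n) (expansion-< n d<P) ⟩
    suc (d n) * P ^ n             ≤⟨ *-monoˡ-≤ (P ^ n) (d<P n) ⟩
    P ^ suc n                     ∎
    where open ≤-Reasoning

  expansion-<-of-last-< : ∀ {d e} m → (∀ i → d i < P) → d m < e m →
                          expansion d (suc m) < expansion e (suc m)
  expansion-<-of-last-< {d} {e} m d<P dₘ<eₘ = begin-strict
    expansion d m + d m * P ^ m   <⟨ +-monoˡ-< (d m * P ^ m) (expansion-< m d<P) ⟩
    suc (d m) * P ^ m             ≤⟨ *-monoˡ-≤ (P ^ m) dₘ<eₘ ⟩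
    e m * P ^ m                   ≤⟨ m≤n+m (e m * P ^ m) (expansion e m) ⟩
    expansion e m + e m * P ^ m   ∎
    where open ≤-Reasoning

  digit-expansion : ∀ {d} n {i} → (∀ i → d i < P) → i < n → digit P (expansion d n) i ≡ d i
  digit-expansion {d} (suc m) {i} d<P i<1+m
    rewrite *-comm (d m) (P ^ m) with m<1+n⇒m<n∨m≡n i<1+m
  ... | inj₁ i<m = trans (digit-+-*^-low (expansion d m) (d m) i<m) (digit-expansion m d<P i<m)
  ... | inj₂ refl = begin
    digit P (expansion d i + P ^ i * d i) i         ≡⟨ cong (digit P _) (+-identityʳ i) ⟨
    digit P (expansion d i + P ^ i * d i) (i + 0)   ≡⟨ digit-+-*^-high (d i) i 0 (expansion-< i d<P) ⟩
    digit P (d i) 0                                 ≡⟨ digit-0-<P (d<P i) ⟩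
    d i                                             ∎
    where open ≡-Reasoning

  sh-<-of-leading-< : ∀ {g} {b c : Fin g → ℕ} {j} → (∀ i → b i < P) →
                      leading g b j < leading g c j → sh g P b j < sh g P c j
  sh-<-of-leading-< {zero}  {j = ()}
  sh-<-of-leading-< {suc h} {b} {c} {j} b<P =
    expansion-<-of-last-< {λ i → b (negPlus (suc h) j i)} {λ i → c (negPlus (suc h) j i)} h (λ i → b<P _)

  sh-≥-transfer : ∀ {g g′} {b c : Fin g → ℕ} {b′ c′ : Fin g′ → ℕ} {j j′} →
                  (∀ i → b i < P) → (∀ i → c′ i < P) → leading g b j ≢ leading g c j →
                  leading g′ b′ j′ ≡ leading g b j → leading g′ c′ j′ ≡ leading g c j →
                  sh g P b j ≥ sh g P c j → sh g′ P b′ j′ ≥ sh g′ P c′ j′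
  sh-≥-transfer {g} {g′} {b} {c} {b′} {c′} {j} {j′} b<P c′<P b≢c b′≡b c′≡c sh-b≥c =
    <⇒≤ (sh-<-of-leading-< {b = c′} {b′} c′<P
      (subst₂ _<_ (sym c′≡c) (sym b′≡b) (≤∧≢⇒< leading-b≥c (≢-sym b≢c))))
    where
    leading-b≥c : leading g b j ≥ leading g c j
    leading-b≥c = ≮⇒≥ (λ b<c → <⇒≱ (sh-<-of-leading-< {b = b} {c} b<P b<c) sh-b≥c)

toℕ-negPlus-last : ∀ {g} (j : Fin g) → toℕ (negPlus g j (pred g)) ≡ pred g ∸ toℕ j
toℕ-negPlus-last {suc h} j = begin
  toℕ (negPlus (suc h) j h)              ≡⟨ toℕ-fromℕ< _ ⟩
  (h + (suc h ∸ toℕ j)) % suc h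
    ≡⟨ cong (λ z → (h + z) % suc h) (+-∸-assoc 1 (s≤s⁻¹ (toℕ<n j))) ⟩
  (h + suc (h ∸ toℕ j)) % suc h          ≡⟨ cong (_% suc h) (wrap-around h (h ∸ toℕ j)) ⟩
  (h ∸ toℕ j + 1 * suc h) % suc h        ≡⟨ [m+kn]%n≡m%n (h ∸ toℕ j) 1 (suc h) ⟩
  (h ∸ toℕ j) % suc h                    ≡⟨ m<n⇒m%n≡m (s≤s (m∸n≤m h (toℕ j))) ⟩
  h ∸ toℕ j                              ∎
  where
  open ≡-Reasoning
  wrap-around : ∀ h d → h + suc d ≡ d + 1 * suc h
  wrap-around = solve-∀

negPlus-last : ∀ {h} (j : Fin (suc h)) → negPlus (suc h) j h ≡ fromℕ< (m%n<n (h ∸ toℕ j) (suc h))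
negPlus-last {h} j = toℕ-injective (begin
  toℕ (negPlus (suc h) j h)                      ≡⟨ toℕ-negPlus-last j ⟩
  h ∸ toℕ j                                      ≡⟨ m<n⇒m%n≡m (s≤s (m∸n≤m h (toℕ j))) ⟨
  (h ∸ toℕ j) % suc h                            ≡⟨ toℕ-fromℕ< _ ⟨
  toℕ (fromℕ< (m%n<n (h ∸ toℕ j) (suc h)))       ∎)
  where open ≡-Reasoning

-- Counted down from the top digit of an f r-digit number, position J + Q f is digit f − 1 − J
-- of block r − 1 − Q.
last-∸-block : ∀ {f₀ r J Q} → J ≤ f₀ → Q < r →
               pred (suc f₀ * r) ∸ (J + Q * suc f₀) ≡ (r ∸ suc Q) * suc f₀ + (f₀ ∸ J)
last-∸-block {J = J} {Q} J≤f₀ Q<r with m≤n⇒∃[o]m+o≡n J≤f₀ | m≤n⇒∃[o]m+o≡n Q<r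
... | t , refl | c , refl rewrite m+n∸m≡n (suc Q) c | m+n∸m≡n J t =
  trans (cong (λ z → pred z ∸ (J + Q * suc (J + t))) (sym (split J t Q c)))
        (m+n∸n≡m (c * suc (J + t) + t) (J + Q * suc (J + t)))
  where
  split : ∀ J t Q c → suc (c * suc (J + t) + t + (J + Q * suc (J + t))) ≡ suc (J + t) * (suc Q + c)
  split = solve-∀

pow-+ : ∀ (σ : S₃) m n x → pow σ (m + n) ⟨$⟩ʳ x ≡ pow σ m ⟨$⟩ʳ (pow σ n ⟨$⟩ʳ x)
pow-+ σ zero    n x = refl
pow-+ σ (suc m) n x = cong (σ ⟨$⟩ʳ_) (pow-+ σ m n x)

pow-sτ-order : ∀ {r} → r ≡ 2 ⊎ r ≡ 3 → ∀ x → pow (sτ r) r ⟨$⟩ʳ x ≡ x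
pow-sτ-order (inj₁ refl) 0F = refl
pow-sτ-order (inj₁ refl) 1F = refl
pow-sτ-order (inj₁ refl) 2F = refl
pow-sτ-order (inj₂ refl) 0F = refl
pow-sτ-order (inj₂ refl) 1F = refl
pow-sτ-order (inj₂ refl) 2F = refl

pow-sτ-complement : ∀ {r Q} → r ≡ 2 ⊎ r ≡ 3 → Q < r → ∀ x →
                    pow (sτ r) (r ∸ suc Q) ⟨$⟩ʳ (pow (sτ r) (suc Q) ⟨$⟩ʳ x) ≡ x
pow-sτ-complement {r} {Q} r∈ Q<r x = begin
  pow (sτ r) (r ∸ suc Q) ⟨$⟩ʳ (pow (sτ r) (suc Q) ⟨$⟩ʳ x)
    ≡⟨ pow-+ (sτ r) (r ∸ suc Q) (suc Q) x ⟨
  pow (sτ r) (r ∸ suc Q + suc Q) ⟨$⟩ʳ x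
    ≡⟨ cong (λ n → pow (sτ r) n ⟨$⟩ʳ x) (m∸n+n≡m Q<r) ⟩
  pow (sτ r) r ⟨$⟩ʳ x
    ≡⟨ pow-sτ-order r∈ x ⟩
  x ∎
  where open ≡-Reasoning

module TameType (q f₀ : ℕ) (a : Fin 3 → Fin (suc f₀) → ℕ) (a<P : ∀ k j → a k j < suc q) where
  open BaseExpansion q

  F : ℕ
  F = suc f₀

  residue : ℕ → Fin F
  residue t = fromℕ< (m%n<n t F)

  A : Fin 3 → ℕ
  A = A0 P F a

  A-< : ∀ k → A k < P ^ F
  A-< k = expansion-< F (λ i → a<P k _)

  digit-A : ∀ k {t} → t < F → digit P (A k) t ≡ a k (residue t)
  digit-A k = digit-expansion F (λ i → a<P k _)

  τexp-2 : ∀ k → τexp P F 2 a k ≡ A k + P ^ F * A (pow (sτ 2) 1 ⟨$⟩ʳ k)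
  τexp-2 0F = refl
  τexp-2 1F = refl
  τexp-2 2F = refl

  τexp-3 : ∀ k → τexp P F 3 a k ≡
           A k + P ^ F * A (pow (sτ 3) 1 ⟨$⟩ʳ k) + P ^ (2 * F) * A (pow (sτ 3) 2 ⟨$⟩ʳ k)
  τexp-3 0F = refl
  τexp-3 1F = refl
  τexp-3 2F = refl

  τexp-2-digit : ∀ {c t} k → c < 2 → t < F →
                 digit P (τexp P F 2 a k) (c * F + t) ≡ a (pow (sτ 2) c ⟨$⟩ʳ k) (residue t)
  τexp-2-digit {0} k _ t<F rewrite τexp-2 k =
    trans (digit-+-*^-low (A k) B {n = F} t<F) (digit-A k t<F)
    where
    B : ℕ
    B = A (pow (sτ 2) 1 ⟨$⟩ʳ k)
  τexp-2-digit {1} {t} k _ t<F rewrite τexp-2 k = begin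
    digit P (A k + P ^ F * B) ((F + 0) + t)
      ≡⟨ cong (λ n → digit P (A k + P ^ F * B) (n + t)) (+-identityʳ F) ⟩
    digit P (A k + P ^ F * B) (F + t)         ≡⟨ digit-+-*^-high B F t (A-< k) ⟩
    digit P B t                               ≡⟨ digit-A _ t<F ⟩
    a (pow (sτ 2) 1 ⟨$⟩ʳ k) (residue t)       ∎
    where
    open ≡-Reasoning
    B : ℕ
    B = A (pow (sτ 2) 1 ⟨$⟩ʳ k)
  τexp-2-digit {suc (suc _)} k (s≤s (s≤s ()))

  τexp-3-digit : ∀ {c t} k → c < 3 → t < F →
                 digit P (τexp P F 3 a k) (c * F + t) ≡ a (pow (sτ 3) c ⟨$⟩ʳ k) (residue t)
  τexp-3-digit {c} {t} k c<3 t<F rewrite τexp-3 k = by-block c c<3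
    where
    open ≡-Reasoning
    B C : ℕ
    B = A (pow (sτ 3) 1 ⟨$⟩ʳ k)
    C = A (pow (sτ 3) 2 ⟨$⟩ʳ k)
    by-block : ∀ c → c < 3 →
               digit P (A k + P ^ F * B + P ^ (2 * F) * C) (c * F + t)
               ≡ a (pow (sτ 3) c ⟨$⟩ʳ k) (residue t)
    by-block 0 _ = begin
      digit P (A k + P ^ F * B + P ^ (2 * F) * C) t
        ≡⟨ digit-+-*^-low _ C {n = 2 * F} (<-≤-trans t<F (m≤m+n F _)) ⟩
      digit P (A k + P ^ F * B) t                     ≡⟨ digit-+-*^-low (A k) B {n = F} t<F ⟩
      digit P (A k) t                                 ≡⟨ digit-A k t<F ⟩
      a k (residue t)                                 ∎
    by-block 1 _ = begin
      digit P (A k + P ^ F * B + P ^ (2 * F) * C) ((F + 0) + t)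
        ≡⟨ cong (λ n → digit P (A k + P ^ F * B + P ^ (2 * F) * C) (n + t)) (+-identityʳ F) ⟩
      digit P (A k + P ^ F * B + P ^ (2 * F) * C) (F + t)
        ≡⟨ digit-+-*^-low _ C {n = 2 * F} (+-monoʳ-< F (<-≤-trans t<F (m≤m+n F 0))) ⟩
      digit P (A k + P ^ F * B) (F + t)               ≡⟨ digit-+-*^-high B F t (A-< k) ⟩
      digit P B t                                     ≡⟨ digit-A _ t<F ⟩
      a (pow (sτ 3) 1 ⟨$⟩ʳ k) (residue t)             ∎
    by-block 2 _ = begin
      digit P (A k + P ^ F * B + P ^ (2 * F) * C) (2 * F + t)
        ≡⟨ digit-+-*^-high C (2 * F) t (+-*^-< {n = F} {F + 0} (A-< k) B<P^[F+0]) ⟩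
      digit P C t                                     ≡⟨ digit-A _ t<F ⟩
      a (pow (sτ 3) 2 ⟨$⟩ʳ k) (residue t)             ∎
      where
      B<P^[F+0] : B < P ^ (F + 0)
      B<P^[F+0] = subst (λ n → B < P ^ n) (sym (+-identityʳ F)) (A-< _)
    by-block (suc (suc (suc _))) (s≤s (s≤s (s≤s ())))

  τexp-digit : ∀ {r c t} k → r ≡ 2 ⊎ r ≡ 3 → c < r → t < F →
               digit P (τexp P F r a k) (c * F + t) ≡ a (pow (sτ r) c ⟨$⟩ʳ k) (residue t)
  τexp-digit k (inj₁ refl) = τexp-2-digit k
  τexp-digit k (inj₂ refl) = τexp-3-digit k

  leading-a′ : ∀ {r} → r ≡ 2 ⊎ r ≡ 3 → (s : Fin F → S₃) (j′ : Fin (F * r)) (x : Fin 3) →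
               leading (F * r) (a′ P F r a (s′ F r s j′ ⟨$⟩ʳ x)) j′
               ≡ leading F (a (s (residue (toℕ j′)) ⟨$⟩ʳ x)) (residue (toℕ j′))
  leading-a′ {r} r∈ s j′ x = begin
    digit P (τexp P F r a k) (toℕ (negPlus (F * r) j′ (pred (F * r))))
      ≡⟨ cong (digit P (τexp P F r a k)) position ⟩
    digit P (τexp P F r a k) ((r ∸ suc Q) * F + (f₀ ∸ toℕ J))
      ≡⟨ τexp-digit k r∈ (∸-monoʳ-< z<s Q<r) (s≤s (m∸n≤m f₀ (toℕ J))) ⟩
    a (pow (sτ r) (r ∸ suc Q) ⟨$⟩ʳ k) (residue (f₀ ∸ toℕ J))
      ≡⟨ cong₂ a (pow-sτ-complement r∈ Q<r (s J ⟨$⟩ʳ x)) (sym (negPlus-last J)) ⟩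
    a (s J ⟨$⟩ʳ x) (negPlus F J f₀)
      ∎
    where
    open ≡-Reasoning
    J : Fin F
    J = residue (toℕ j′)
    Q : ℕ
    Q = toℕ j′ / F
    k : Fin 3
    k = s′ F r s j′ ⟨$⟩ʳ x
    Q<r : Q < r
    Q<r = m<n*o⇒m/o<n (subst (toℕ j′ <_) (*-comm F r) (toℕ<n j′))
    position : toℕ (negPlus (F * r) j′ (pred (F * r))) ≡ (r ∸ suc Q) * F + (f₀ ∸ toℕ J)
    position = begin
      toℕ (negPlus (F * r) j′ (pred (F * r)))   ≡⟨ toℕ-negPlus-last j′ ⟩
      pred (F * r) ∸ toℕ j′                     ≡⟨ cong (pred (F * r) ∸_) (m≡m%n+[m/n]*n (toℕ j′) F) ⟩
      pred (F * r) ∸ (toℕ j′ % F + Q * F)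
        ≡⟨ cong (λ n → pred (F * r) ∸ (n + Q * F)) (toℕ-fromℕ< (m%n<n (toℕ j′) F)) ⟨
      pred (F * r) ∸ (toℕ J + Q * F)            ≡⟨ last-∸-block (s≤s⁻¹ (toℕ<n J)) Q<r ⟩
      (r ∸ suc Q) * F + (f₀ ∸ toℕ J)            ∎

3≤∣m-n∣⇒m≢n : ∀ {m n} → 3 ≤ ∣ m - n ∣ → m ≢ n
3≤∣m-n∣⇒m≢n {m} 3≤∣m-m∣ refl with () ← subst (3 ≤_) (∣n-n∣≡0 m) 3≤∣m-m∣

weaklyGeneric⇒≢ : ∀ p f a → WeaklyGeneric p f a → ∀ j {k l} → k ≢ l → a k j ≢ a l j
weaklyGeneric⇒≢ _ _ _ wg j {0F} {0F} k≢l = contradiction refl k≢l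
weaklyGeneric⇒≢ _ _ _ wg j {0F} {1F} _   = 3≤∣m-n∣⇒m≢n (proj₁ (proj₁ (wg j)))
weaklyGeneric⇒≢ _ _ _ wg j {0F} {2F} _   = 3≤∣m-n∣⇒m≢n (proj₁ (proj₂ (proj₂ (wg j))))
weaklyGeneric⇒≢ _ _ _ wg j {1F} {0F} _   = ≢-sym (3≤∣m-n∣⇒m≢n (proj₁ (proj₁ (wg j))))
weaklyGeneric⇒≢ _ _ _ wg j {1F} {1F} k≢l = contradiction refl k≢l
weaklyGeneric⇒≢ _ _ _ wg j {1F} {2F} _   = 3≤∣m-n∣⇒m≢n (proj₁ (proj₁ (proj₂ (wg j))))
weaklyGeneric⇒≢ _ _ _ wg j {2F} {0F} _   = ≢-sym (3≤∣m-n∣⇒m≢n (proj₁ (proj₂ (proj₂ (wg j)))))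
weaklyGeneric⇒≢ _ _ _ wg j {2F} {1F} _   = ≢-sym (3≤∣m-n∣⇒m≢n (proj₁ (proj₁ (proj₂ (wg j)))))
weaklyGeneric⇒≢ _ _ _ wg j {2F} {2F} k≢l = contradiction refl k≢l

proposition6p1 : (p f r : ℕ) .{{_ : NonZero f}} → Prime p → 3 < p
    → (r ≡ 2 ⊎ r ≡ 3)
    → (a : Fin 3 → Fin f → ℕ) → (∀ k j → a k j < p)
    → WeaklyGeneric p f a
    → (s : Fin f → S₃) → IsOrientation f p a s
    → IsOrientation (f * r) p (a′ p f r a) (s′ f r s)
proposition6p1 zero    _        _ _ ()  _  _ _   _  _ _         _
proposition6p1 (suc q) zero     _ _ _   _  _ _   _  _ _         ()
proposition6p1 (suc q) (suc f₀) r _ _   r∈ a a<p wg s s-orients j′ =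
  orient 0F 1F (λ ()) (proj₁ (s-orients J)) , orient 1F 2F (λ ()) (proj₂ (s-orients J))
  where
  open BaseExpansion q
  open TameType q f₀ a a<p
  J : Fin F
  J = residue (toℕ j′)
  u t : S₃
  u = s J
  t = s′ F r s j′
  b′ : Fin 3 → Fin (F * r) → ℕ
  b′ = a′ P F r a
  orient : ∀ x y → x ≢ y → sh F P (a (u ⟨$⟩ʳ x)) J ≥ sh F P (a (u ⟨$⟩ʳ y)) J →
           sh (F * r) P (b′ (t ⟨$⟩ʳ x)) j′ ≥ sh (F * r) P (b′ (t ⟨$⟩ʳ y)) j′
  orient x y x≢y =
    sh-≥-transfer {b = a (u ⟨$⟩ʳ x)} {a (u ⟨$⟩ʳ y)} {b′ (t ⟨$⟩ʳ x)} {b′ (t ⟨$⟩ʳ y)} {J} {j′}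
      (a<p _) (λ i → digit<P _ (toℕ i))
      (weaklyGeneric⇒≢ P F a wg (negPlus F J f₀) (x≢y ∘ Injection.injective (↔⇒↣ u)))
      (leading-a′ r∈ s j′ x) (leading-a′ r∈ s j′ y)
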